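{- Let $\mathcal{B}$ be the set of Łukasiewicz paths having no flat step $F$ at positive height. For every $n\geq 0$, there is a bijection between the set of paths of length $n$ in $\mathcal{B}$ and the set of $U_k$-equivalence classes of the set $\mathcal{L}_n$ of Łukasiewicz paths of length $n$.
   Context: A Łukasiewicz path of length $n$ is a sequence of $n$ steps from $\{(1,i): i\geq -1\}$ starting at $(0,0)$, ending at $(n,0)$ and never going below the $x$-axis. Write $D=(1,-1)$, $F=(1,0)$, $U=U_1=(1,1)$, $U_k=(1,k)$. The height of a step is the minimal ordinate of its two endpoints. Steps are numbered $1,\dots,n$. Two Łukasiewicz paths of the same length are $U_k$-equivalent if for every $k\geq 1$ the set of positions of the steps $U_k$ is the same in both paths. -}

module Defs where

open import Level using (0ℓ)
open import Data.Nat using (ℕ; zero; suc; _+_)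
open import Data.Fin using (Fin)
open import Data.Vec using (Vec; []; _∷_; lookup)
open import Data.Product using (Σ; _×_; _,_; proj₁; proj₂)
open import Data.Empty using (⊥)
open import Data.Unit using (⊤)
open import Function.Base using (id; _∘_)
open import Function.Bundles using (_⇔_; mk⇔; Equivalence)
open import Relation.Binary.Bundles using (Setoid)
open import Relation.Binary.PropositionalEquality using (_≡_)
import Relation.Binary.PropositionalEquality as P

-- Steps of a Łukasiewicz path: D = (1,-1), F = (1,0),
-- and  U k  stands for the up step U_{k+1} = (1, k+1)  (so U 0 is U = U_1).
data Step : Set where
  D : Step
  F : Step
  U : ℕ → Step

LukFrom : {n : ℕ} → ℕ → Vec Step n → Set
LukFrom h []               = h ≡ 0
LukFrom zero    (D ∷ s)    = ⊥
LukFrom (suc h) (D ∷ s)    = LukFrom h s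
LukFrom h       (F ∷ s)    = LukFrom h s
LukFrom h       (U k ∷ s)  = LukFrom (h + suc k) s

IsLuk : {n : ℕ} → Vec Step n → Set
IsLuk = LukFrom 0

-- NoFlatFrom h s : started at height h, every flat step F of s has height 0.
-- (The height of an F step is the ordinate of its endpoints.)
NoFlatFrom : {n : ℕ} → ℕ → Vec Step n → Set
NoFlatFrom h []               = ⊤
NoFlatFrom zero    (D ∷ s)    = NoFlatFrom zero s   -- never happens on a Łukasiewicz path
NoFlatFrom (suc h) (D ∷ s)    = NoFlatFrom h s
NoFlatFrom h       (F ∷ s)    = (h ≡ 0) × NoFlatFrom h s
NoFlatFrom h       (U k ∷ s)  = NoFlatFrom (h + suc k) s

B : ℕ → Set
B n = Σ (Vec Step n) (λ p → IsLuk p × NoFlatFrom 0 p)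

L : ℕ → Set
L n = Σ (Vec Step n) IsLuk

-- U_k-equivalence: for every k ≥ 1 (here U k = U_{k+1}, k ≥ 0) the set of
-- positions of U_k steps is the same in both paths.
_∼U_ : {n : ℕ} → Vec Step n → Vec Step n → Set
_∼U_ {n} p q = (k : ℕ) (i : Fin n) → (lookup p i ≡ U k) ⇔ (lookup q i ≡ U k)

private
  ⇔-sym : {A B : Set} → A ⇔ B → B ⇔ A
  ⇔-sym e = mk⇔ (Equivalence.from e) (Equivalence.to e)
  ⇔-trans : {A B C : Set} → A ⇔ B → B ⇔ C → A ⇔ C
  ⇔-trans e f = mk⇔ (Equivalence.to f ∘ Equivalence.to e) (Equivalence.from e ∘ Equivalence.from f)

-- L_n as a setoid under U_k-equivalence (its quotient = the set of classes).
LSetoid : ℕ → Setoid 0ℓ 0ℓ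
LSetoid n = record
  { Carrier = L n
  ; _≈_ = λ p q → proj₁ p ∼U proj₁ q
  ; isEquivalence = record
    { refl = λ k i → mk⇔ id id
    ; sym = λ e k i → ⇔-sym (e k i)
    ; trans = λ e f k i → ⇔-trans (e k i) (f k i)
    }
  }

BSetoid : ℕ → Setoid 0ℓ 0ℓ
BSetoid n = record
  { Carrier = B n
  ; _≈_ = λ p q → proj₁ p ≡ proj₁ q
  ; isEquivalence = record { refl = P.refl ; sym = P.sym ; trans = P.trans }
  }

-- A U_k-class is determined by its up-word, the sequence recording at each position which U_k
-- (if any) occurs there. Every up-word w has a canonical realisation: fill the other positions
-- with D when the current height is positive and with F at height 0. It has no F at positive
-- height, and it never lies above any path with up-word w, so it is a Łukasiewicz path as soon
-- as some Łukasiewicz path has up-word w. A path of B is the canonical realisation of its own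
-- up-word, so B meets every class exactly once.
module Submission where

open import Defs
open import Data.Nat using (ℕ; zero; suc; _+_; _≤_; z≤n; s≤s)
open import Data.Nat.Properties using (+-monoˡ-≤; ≤-trans; n≤1+n; n≤0⇒n≡0)
open import Data.Fin using () renaming (zero to fzero; suc to fsuc)
open import Data.Maybe using (Maybe; just; nothing)
open import Data.Maybe.Properties using (just-injective)
open import Data.Vec using (Vec; []; _∷_; map)
open import Data.Vec.Properties using (∷-injective)
open import Data.Product using (Σ; _,_; proj₁; proj₂)
open import Data.Unit using (tt)
open import Function.Base using (id)
open import Function.Bundles using (Bijection; _⇔_; mk⇔; Equivalence)
open import Relation.Binary.PropositionalEquality
  using (_≡_; refl; sym; trans; cong; cong₂; subst; module ≡-Reasoning)

upIndex : Step → Maybe ℕ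
upIndex (U k) = just k
upIndex D     = nothing
upIndex F     = nothing

upWord : {n : ℕ} → Vec Step n → Vec (Maybe ℕ) n
upWord = map upIndex

upIndex≡just⇒≡U : ∀ {x k} → upIndex x ≡ just k → x ≡ U k
upIndex≡just⇒≡U {U j} e = cong U (just-injective e)

upIndex-cong : ∀ {x y} → (∀ k → (x ≡ U k) ⇔ (y ≡ U k)) → upIndex x ≡ upIndex y
upIndex-cong {U j} e     = cong upIndex (sym (Equivalence.to (e j) refl))
upIndex-cong {x} {U j} e = cong upIndex (Equivalence.from (e j) refl)
upIndex-cong {D} {D} e   = refl
upIndex-cong {D} {F} e   = refl
upIndex-cong {F} {D} e   = refl
upIndex-cong {F} {F} e   = refl

upIndex≡⇒≡U⇔ : ∀ {x y k} → upIndex x ≡ upIndex y → (x ≡ U k) ⇔ (y ≡ U k)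
upIndex≡⇒≡U⇔ e = mk⇔ (λ { refl → upIndex≡just⇒≡U (sym e) }) (λ { refl → upIndex≡just⇒≡U e })

∼U⇒upWord≡ : ∀ {n} {p q : Vec Step n} → p ∼U q → upWord p ≡ upWord q
∼U⇒upWord≡ {p = []}    {[]}    e = refl
∼U⇒upWord≡ {p = _ ∷ _} {_ ∷ _} e =
  cong₂ _∷_ (upIndex-cong (λ k → e k fzero)) (∼U⇒upWord≡ (λ k i → e k (fsuc i)))

upWord≡⇒∼U : ∀ {n} {p q : Vec Step n} → upWord p ≡ upWord q → p ∼U q
upWord≡⇒∼U {p = _ ∷ _} {_ ∷ _} e k fzero    = upIndex≡⇒≡U⇔ (proj₁ (∷-injective e))
upWord≡⇒∼U {p = _ ∷ _} {_ ∷ _} e k (fsuc i) = upWord≡⇒∼U (proj₂ (∷-injective e)) k i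

canonical : {n : ℕ} → ℕ → Vec (Maybe ℕ) n → Vec Step n
canonical h       []            = []
canonical h       (just k ∷ w)  = U k ∷ canonical (h + suc k) w
canonical zero    (nothing ∷ w) = F ∷ canonical zero w
canonical (suc h) (nothing ∷ w) = D ∷ canonical h w

-- LukFrom and NoFlatFrom split on the height before the step, so their U clauses need these.
LukFrom-U : ∀ {n} h k (s : Vec Step n) → LukFrom h (U k ∷ s) ≡ LukFrom (h + suc k) s
LukFrom-U zero    k s = refl
LukFrom-U (suc h) k s = refl

LukFrom-F : ∀ {n} h (s : Vec Step n) → LukFrom h (F ∷ s) ≡ LukFrom h s
LukFrom-F zero    s = refl
LukFrom-F (suc h) s = refl

NoFlatFrom-U : ∀ {n} h k (s : Vec Step n) → NoFlatFrom h (U k ∷ s) ≡ NoFlatFrom (h + suc k) s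
NoFlatFrom-U zero    k s = refl
NoFlatFrom-U (suc h) k s = refl

upWord-canonical : ∀ {n} h (w : Vec (Maybe ℕ) n) → upWord (canonical h w) ≡ w
upWord-canonical h       []            = refl
upWord-canonical h       (just k ∷ w)  = cong (just k ∷_) (upWord-canonical (h + suc k) w)
upWord-canonical zero    (nothing ∷ w) = cong (nothing ∷_) (upWord-canonical zero w)
upWord-canonical (suc h) (nothing ∷ w) = cong (nothing ∷_) (upWord-canonical h w)

canonical-noFlat : ∀ {n} h (w : Vec (Maybe ℕ) n) → NoFlatFrom h (canonical h w)
canonical-noFlat h       []            = tt
canonical-noFlat h       (just k ∷ w)  =
  subst id (sym (NoFlatFrom-U h k (canonical (h + suc k) w))) (canonical-noFlat (h + suc k) w)
canonical-noFlat zero    (nothing ∷ w) = refl , canonical-noFlat zero w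
canonical-noFlat (suc h) (nothing ∷ w) = canonical-noFlat h w

-- Induction keeps the canonical path weakly below p: h is its height, h' that of p.
canonical-isLuk : ∀ {n} h h' (p : Vec Step n) → h ≤ h' → LukFrom h' p →
                  LukFrom h (canonical h (upWord p))
canonical-isLuk h       h'       []        h≤h' h'≡0 = n≤0⇒n≡0 (subst (h ≤_) h'≡0 h≤h')
canonical-isLuk h       h'       (U k ∷ p) h≤h' l    =
  subst id (sym (LukFrom-U h k (canonical (h + suc k) (upWord p))))
    (canonical-isLuk (h + suc k) (h' + suc k) p (+-monoˡ-≤ (suc k) h≤h')
      (subst id (LukFrom-U h' k p) l))
canonical-isLuk zero    (suc h') (D ∷ p)   h≤h'      l = canonical-isLuk zero h' p z≤n l
canonical-isLuk (suc h) (suc h') (D ∷ p)   (s≤s h≤h') l = canonical-isLuk h h' p h≤h' l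
canonical-isLuk zero    h'       (F ∷ p)   h≤h' l    =
  canonical-isLuk zero h' p z≤n (subst id (LukFrom-F h' p) l)
canonical-isLuk (suc h) h'       (F ∷ p)   h≤h' l    =
  canonical-isLuk h h' p (≤-trans (n≤1+n h) h≤h') (subst id (LukFrom-F h' p) l)

canonical-upWord : ∀ {n} h (p : Vec Step n) → LukFrom h p → NoFlatFrom h p →
                   canonical h (upWord p) ≡ p
canonical-upWord h       []        l nf       = refl
canonical-upWord h       (U k ∷ p) l nf       = cong (U k ∷_)
  (canonical-upWord (h + suc k) p (subst id (LukFrom-U h k p) l) (subst id (NoFlatFrom-U h k p) nf))
canonical-upWord (suc h) (D ∷ p)   l nf       = cong (D ∷_) (canonical-upWord h p l nf)
canonical-upWord zero    (F ∷ p)   l (_ , nf) = cong (F ∷_) (canonical-upWord zero p l nf)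
canonical-upWord (suc h) (F ∷ p)   l (() , _)

lemma2 : (n : ℕ) → Bijection (BSetoid n) (LSetoid n)
lemma2 n = record
  { to        = λ b → proj₁ b , proj₁ (proj₂ b)
  ; cong      = λ e → upWord≡⇒∼U (cong upWord e)
  ; bijective = (λ {x} {y} → injective {x} {y}) , surjective
  }
  where
  open ≡-Reasoning

  injective : ∀ {x y : B n} → proj₁ x ∼U proj₁ y → proj₁ x ≡ proj₁ y
  injective {p , lp , nfp} {q , lq , nfq} p∼q = begin
    p                        ≡⟨ sym (canonical-upWord 0 p lp nfp) ⟩
    canonical 0 (upWord p)   ≡⟨ cong (canonical 0) (∼U⇒upWord≡ p∼q) ⟩
    canonical 0 (upWord q)   ≡⟨ canonical-upWord 0 q lq nfq ⟩
    q                        ∎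

  surjective : (y : L n) → Σ (B n) λ x → ∀ {z : B n} → proj₁ z ≡ proj₁ x → proj₁ z ∼U proj₁ y
  surjective (p , l) =
    (canonical 0 (upWord p) , canonical-isLuk 0 0 p z≤n l , canonical-noFlat 0 (upWord p)) ,
    λ {_} z≡c → upWord≡⇒∼U (trans (cong upWord z≡c) (upWord-canonical 0 (upWord p)))
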